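{- Let $x$ denote the operator of multiplication by the variable $x$ and let $\mathrm{I}$ denote the integration operator $(\mathrm{I}f)(x)=\int_0^x f(t)\,dt$, both acting on continuous functions of a real variable. Let $\lambda,\delta\ge 1$ be integers. Define integers $a^{(\lambda,\delta)}_{n,k}$ for $n\ge 1$ and $0\le k\le \lambda(n-1)$ by $a^{(\lambda,\delta)}_{1,0}=1$ and, for $n\ge 1$ and $0\le j\le \lambda n$, \[ a^{(\lambda,\delta)}_{n+1,j}=\sum_{k=0}^{\min(j,\lambda(n-1))}(\lambda n-k)_{j-k}\binom{j-k+\delta-1}{\delta-1}\,a^{(\lambda,\delta)}_{n,k}. \] Then for every $n\ge 1$ the following operator identity holds: \[ (x^\lambda\mathrm{I}^\delta)^n=\sum_{k=0}^{\lambda(n-1)}(-1)^k\,a^{(\lambda,\delta)}_{n,k}\,x^{\lambda n-k}\,\mathrm{I}^{\,\delta n+k}. \]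
   Context: Products of operators denote composition (the rightmost operator acts first); $x^i\mathrm{I}^j$ means apply $\mathrm{I}$ $j$ times and then multiply by $x^i$. The operators satisfy $\mathrm{I}x-x\mathrm{I}=-\mathrm{I}^2$. $(\alpha)_j=\alpha(\alpha-1)\cdots(\alpha-j+1)$ denotes the falling factorial, with $(\alpha)_0=1$. -}

module Defs where

open import Level using (Level)
open import Data.Nat using (ℕ; zero; suc; _+_; _*_; _∸_; _⊓_)
open import Data.Nat.Combinatorics using (_C_)
open import Algebra.Bundles using (Ring)

falling : ℕ → ℕ → ℕ
falling α zero    = 1
falling α (suc j) = α * falling (α ∸ 1) j

sumℕ : ℕ → (ℕ → ℕ) → ℕ
sumℕ zero    f = f 0
sumℕ (suc N) f = sumℕ N f + f (suc N)

-- A λ δ m k = a^{(λ,δ)}_{m+1,k}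
A : ℕ → ℕ → ℕ → ℕ → ℕ
A λ' δ zero    zero    = 1
A λ' δ zero    (suc k) = 0
A λ' δ (suc m) j =
  sumℕ (j ⊓ (λ' * m)) (λ k →
    falling (λ' * suc m ∸ k) (j ∸ k) * ((j ∸ k + (δ ∸ 1)) C (δ ∸ 1)) * A λ' δ m k)

-- paper indexing: a^{(λ,δ)}_{n,k}, meaningful for n ≥ 1
a : ℕ → ℕ → ℕ → ℕ → ℕ
a λ' δ n k = A λ' δ (n ∸ 1) k

module RingOps {c ℓ : Level} (R : Ring c ℓ) where
  open Ring R using (Carrier; 0#; 1#; -_) renaming (_*_ to _·_; _+_ to _⊕_)

  pow : Carrier → ℕ → Carrier
  pow y zero    = 1#
  pow y (suc n) = y · pow y n

  nmul : ℕ → Carrier → Carrier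
  nmul zero    y = 0#
  nmul (suc n) y = y ⊕ nmul n y

  sign : ℕ → Carrier
  sign k = pow (- 1#) k

  sumR : ℕ → (ℕ → Carrier) → Carrier
  sumR zero    f = f 0
  sumR (suc N) f = sumR N f ⊕ f (suc N)

module Submission where

-- The commutation rule I x = x I - I² gives I^q x = x I^q - q I^(q+1), and by induction on m
-- the normal-ordered form (all x left of all I)
--   I^δ x^m = Σ_i (-1)^i (m)_i C(δ-1+i, i) x^(m-i) I^(δ+i),
-- the two terms produced at each step recombining through Pascal-type recurrences for (m)_i
-- and C(δ-1+i, i). Multiplying the normal-ordered (x^λ I^δ)^n on the left by x^λ I^δ and
-- applying this to every I^δ x^(λn-k) yields a double sum over k and i; grouping the terms with
-- k + i = j reproduces the recurrence defining a_{n+1,j}. The coefficients enter the ring as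
-- (-1)^k (a × 1), which are central, so no commutativity is needed.

open import Defs
open import Level using (Level; _⊔_)
open import Algebra.Bundles using (Ring)

module Coefficients where
  open import Data.Nat
  open import Data.Nat.Properties
  open import Data.Nat.Combinatorics using (_C_; nCn≡1; nCk≡nC[n∸k]; nCk+nC[k+1]≡[n+1]C[k+1])
  open import Algebra.Properties.CommutativeSemigroup *-commutativeSemigroup using (xy∙z≈y∙xz; x∙yz≈y∙xz)
  open import Relation.Nullary using (yes; no)
  open import Data.Nat.Tactic.RingSolver using (solve-∀)
  open import Data.Sum using (inj₁; inj₂)
  open import Data.Empty using (⊥-elim)
  open import Relation.Binary.PropositionalEquality
  open ≡-Reasoning

  falling-< : ∀ {α β} → α < β → falling α β ≡ 0
  falling-< {zero}  {suc β} _         = refl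
  falling-< {suc α} {suc β} (s≤s α<β) = trans (cong (suc α *_) (falling-< α<β)) (*-zeroʳ α)

  falling-sucʳ : ∀ α β → falling α (suc β) ≡ falling α β * (α ∸ β)
  falling-sucʳ α zero    = *-comm α 1
  falling-sucʳ α (suc β) = begin
    α * falling (α ∸ 1) (suc β)           ≡⟨ cong (α *_) (falling-sucʳ (α ∸ 1) β) ⟩
    α * (falling (α ∸ 1) β * (α ∸ 1 ∸ β)) ≡⟨ *-assoc α _ _ ⟨
    falling α (suc β) * (α ∸ 1 ∸ β)       ≡⟨ cong (falling α (suc β) *_) (∸-+-assoc α 1 β) ⟩
    falling α (suc β) * (α ∸ suc β)       ∎

  falling-suc-suc : ∀ α β → falling (suc α) (suc β) ≡ falling α (suc β) + suc β * falling α β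
  falling-suc-suc α β with β ≤? α
  ... | yes β≤α = begin
    suc α * falling α β                           ≡⟨ cong (_* falling α β) (sym α∸β+1+β≡1+α) ⟩
    (α ∸ β + suc β) * falling α β                 ≡⟨ *-distribʳ-+ (falling α β) (α ∸ β) (suc β) ⟩
    (α ∸ β) * falling α β + suc β * falling α β   ≡⟨ cong (_+ suc β * falling α β) (*-comm (α ∸ β) _) ⟩
    falling α β * (α ∸ β) + suc β * falling α β   ≡⟨ cong (_+ suc β * falling α β) (falling-sucʳ α β) ⟨
    falling α (suc β) + suc β * falling α β       ∎
    where
    α∸β+1+β≡1+α : α ∸ β + suc β ≡ suc α
    α∸β+1+β≡1+α = trans (+-suc (α ∸ β) β) (cong suc (m∸n+n≡m β≤α))
  ... | no β≰α
    rewrite falling-< (≰⇒> β≰α) | falling-< (m<n⇒m<1+n (≰⇒> β≰α)) =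
    trans (*-zeroʳ (suc α)) (sym (*-zeroʳ (suc β)))

  -- C(a+b, a): symmetric in a and b, so the two absorption identities below are proved jointly.
  pascal : ℕ → ℕ → ℕ
  pascal a b = (b + a) C a

  pascal-zeroˡ : ∀ b → pascal 0 b ≡ 1
  pascal-zeroˡ b = begin
    (b + 0) C 0   ≡⟨ nCk≡nC[n∸k] (z≤n {b + 0}) ⟩
    (b + 0) C (b + 0) ≡⟨ nCn≡1 (b + 0) ⟩
    1 ∎

  pascal-zeroʳ : ∀ a → pascal a 0 ≡ 1
  pascal-zeroʳ = nCn≡1

  pascal-suc-suc : ∀ a b → pascal (suc a) (suc b) ≡ pascal a (suc b) + pascal (suc a) b
  pascal-suc-suc a b = begin
    suc (b + suc a) C suc a                 ≡⟨ cong (λ t → suc t C suc a) (+-suc b a) ⟩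
    suc (suc (b + a)) C suc a               ≡⟨ nCk+nC[k+1]≡[n+1]C[k+1] (suc (b + a)) a ⟨
    suc (b + a) C a + suc (b + a) C suc a   ≡⟨ cong (λ t → suc (b + a) C a + t C suc a) (+-suc b a) ⟨
    pascal a (suc b) + pascal (suc a) b     ∎

  suc-*-pascal-sucʳ : ∀ a b → suc b * pascal a (suc b) ≡ suc (a + b) * pascal a b
  suc-*-pascal-sucˡ : ∀ a b → suc a * pascal (suc a) b ≡ suc (a + b) * pascal a b
  suc-*-pascal-sucʳ zero b = cong (suc b *_) (trans (pascal-zeroˡ (suc b)) (sym (pascal-zeroˡ b)))
  suc-*-pascal-sucʳ (suc a) b = begin
    suc b * pascal (suc a) (suc b)                            ≡⟨ cong (suc b *_) (pascal-suc-suc a b) ⟩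
    suc b * (pascal a (suc b) + pascal (suc a) b)             ≡⟨ *-distribˡ-+ (suc b) (pascal a (suc b)) _ ⟩
    suc b * pascal a (suc b) + suc b * pascal (suc a) b
      ≡⟨ cong (_+ suc b * pascal (suc a) b) (trans (suc-*-pascal-sucʳ a b) (sym (suc-*-pascal-sucˡ a b))) ⟩
    suc a * pascal (suc a) b + suc b * pascal (suc a) b       ≡⟨ *-distribʳ-+ (pascal (suc a) b) (suc a) (suc b) ⟨
    (suc a + suc b) * pascal (suc a) b                        ≡⟨ cong (λ t → suc t * pascal (suc a) b) (+-suc a b) ⟩
    suc (suc a + b) * pascal (suc a) b                        ∎
  suc-*-pascal-sucˡ a zero = begin
    suc a * pascal (suc a) 0 ≡⟨ cong (suc a *_) (trans (pascal-zeroʳ (suc a)) (sym (pascal-zeroʳ a))) ⟩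
    suc a * pascal a 0       ≡⟨ cong (λ t → suc t * pascal a 0) (+-identityʳ a) ⟨
    suc (a + 0) * pascal a 0 ∎
  suc-*-pascal-sucˡ a (suc b) = begin
    suc a * pascal (suc a) (suc b)                            ≡⟨ cong (suc a *_) (pascal-suc-suc a b) ⟩
    suc a * (pascal a (suc b) + pascal (suc a) b)             ≡⟨ *-distribˡ-+ (suc a) (pascal a (suc b)) _ ⟩
    suc a * pascal a (suc b) + suc a * pascal (suc a) b
      ≡⟨ cong (suc a * pascal a (suc b) +_) (trans (suc-*-pascal-sucˡ a b) (sym (suc-*-pascal-sucʳ a b))) ⟩
    suc a * pascal a (suc b) + suc b * pascal a (suc b)       ≡⟨ *-distribʳ-+ (pascal a (suc b)) (suc a) (suc b) ⟨
    suc (a + suc b) * pascal a (suc b)                        ∎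

  commCoeff : ℕ → ℕ → ℕ → ℕ
  commCoeff e m i = falling m i * pascal e i

  commCoeff-0-0 : ∀ e → commCoeff e 0 0 ≡ 1
  commCoeff-0-0 e = trans (+-identityʳ (pascal e 0)) (pascal-zeroʳ e)

  commCoeff-< : ∀ e {m i} → m < i → commCoeff e m i ≡ 0
  commCoeff-< e {i = i} m<i = cong (_* pascal e i) (falling-< m<i)

  commCoeff-suc-suc : ∀ e m i →
    commCoeff e (suc m) (suc i) ≡ commCoeff e m (suc i) + suc (e + i) * commCoeff e m i
  commCoeff-suc-suc e m i = begin
    falling (suc m) (suc i) * pascal e (suc i)
      ≡⟨ cong (_* pascal e (suc i)) (falling-suc-suc m i) ⟩
    (falling m (suc i) + suc i * falling m i) * pascal e (suc i)
      ≡⟨ *-distribʳ-+ (pascal e (suc i)) (falling m (suc i)) _ ⟩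
    commCoeff e m (suc i) + suc i * falling m i * pascal e (suc i)
      ≡⟨ cong (commCoeff e m (suc i) +_) (xy∙z≈y∙xz (suc i) (falling m i) (pascal e (suc i))) ⟩
    commCoeff e m (suc i) + falling m i * (suc i * pascal e (suc i))
      ≡⟨ cong (λ t → commCoeff e m (suc i) + falling m i * t) (suc-*-pascal-sucʳ e i) ⟩
    commCoeff e m (suc i) + falling m i * (suc (e + i) * pascal e i)
      ≡⟨ cong (commCoeff e m (suc i) +_) (x∙yz≈y∙xz (falling m i) (suc (e + i)) (pascal e i)) ⟩
    commCoeff e m (suc i) + suc (e + i) * commCoeff e m i
      ∎

  x-exponent : ∀ λ' m {k i} → k + i ≤ λ' * suc m → λ' + (λ' * suc m ∸ k ∸ i) ≡ λ' * suc (suc m) ∸ (k + i)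
  x-exponent λ' m {k} {i} k+i≤λ'[1+m] = begin
    λ' + (λ' * suc m ∸ k ∸ i)     ≡⟨ cong (λ' +_) (∸-+-assoc (λ' * suc m) k i) ⟩
    λ' + (λ' * suc m ∸ (k + i))   ≡⟨ +-∸-assoc λ' k+i≤λ'[1+m] ⟨
    λ' + λ' * suc m ∸ (k + i)     ≡⟨ cong (_∸ (k + i)) (*-suc λ' (suc m)) ⟨
    λ' * suc (suc m) ∸ (k + i)    ∎

  I-exponent : ∀ d m k i → d + i + (d * suc m + k) ≡ d * suc (suc m) + (k + i)
  I-exponent = solve-∀

  sumℕ-cong : ∀ N {f g : ℕ → ℕ} → (∀ k → f k ≡ g k) → sumℕ N f ≡ sumℕ N g
  sumℕ-cong zero    f≗g = f≗g 0
  sumℕ-cong (suc N) f≗g = cong₂ _+_ (sumℕ-cong N f≗g) (f≗g (suc N))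

  sumℕ-zero : ∀ N {f : ℕ → ℕ} → (∀ k → k ≤ N → f k ≡ 0) → sumℕ N f ≡ 0
  sumℕ-zero zero    f≡0 = f≡0 0 z≤n
  sumℕ-zero (suc N) f≡0 = cong₂ _+_ (sumℕ-zero N (λ k k≤N → f≡0 k (m≤n⇒m≤1+n k≤N))) (f≡0 (suc N) ≤-refl)

  sumℕ-shorten : ∀ {M N} {f : ℕ → ℕ} → M ≤ N → (∀ k → M < k → f k ≡ 0) → sumℕ N f ≡ sumℕ M f
  sumℕ-shorten {N = zero}  z≤n _ = refl
  sumℕ-shorten {M} {suc N} {f} M≤1+N f≡0 with m≤n⇒m<n∨m≡n M≤1+N
  ... | inj₂ refl = refl
  ... | inj₁ M<1+N = begin
    sumℕ N f + f (suc N) ≡⟨ cong₂ _+_ (sumℕ-shorten (≤-pred M<1+N) f≡0) (f≡0 (suc N) M<1+N) ⟩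
    sumℕ M f + 0         ≡⟨ +-identityʳ (sumℕ M f) ⟩
    sumℕ M f             ∎

  sumℕ-⊓ : ∀ N M {f : ℕ → ℕ} → (∀ k → M < k → f k ≡ 0) → sumℕ N f ≡ sumℕ (N ⊓ M) f
  sumℕ-⊓ N M {f} f≡0 with ≤-total N M
  ... | inj₁ N≤M = cong (λ t → sumℕ t f) (sym (m≤n⇒m⊓n≡m N≤M))
  ... | inj₂ M≤N = trans (sumℕ-shorten M≤N f≡0) (cong (λ t → sumℕ t f) (sym (m≥n⇒m⊓n≡n M≤N)))

  A-vanishes : ∀ λ' e {m k} → λ' * m < k → A λ' (suc e) m k ≡ 0
  A-vanishes λ' e {zero}  {zero}  λ'm<0 = ⊥-elim (n≮0 (subst (_< 0) (*-zeroʳ λ') λ'm<0))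
  A-vanishes λ' e {zero}  {suc k} _     = refl
  A-vanishes λ' e {suc m} {j}     λ'[1+m]<j = sumℕ-zero (j ⊓ (λ' * m)) λ k k≤j⊓λ'm →
    cong (λ t → t * pascal e (j ∸ k) * A λ' (suc e) m k)
      (falling-< (∸-monoˡ-< λ'[1+m]<j (≤-trans k≤j⊓λ'm (≤-trans (m⊓n≤n j (λ' * m)) (*-monoʳ-≤ λ' (n≤1+n m))))))

  -- The cut-off j ⊓ λ' * m in the definition of A only drops terms that vanish by A-vanishes.
  A-suc : ∀ λ' e m j →
    A λ' (suc e) (suc m) j ≡ sumℕ j (λ k → A λ' (suc e) m k * commCoeff e (λ' * suc m ∸ k) (j ∸ k))
  A-suc λ' e m j = sym (trans
    (sumℕ-⊓ j (λ' * m) (λ k λ'm<k → cong (_* commCoeff e (λ' * suc m ∸ k) (j ∸ k)) (A-vanishes λ' e λ'm<k)))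
    (sumℕ-cong (j ⊓ (λ' * m)) (λ k → *-comm (A λ' (suc e) m k) _)))

module Expansion {c ℓ} (R : Ring c ℓ) where
  open import Data.Nat as ℕ using (ℕ; zero; suc; _∸_; _≤_; _<_; z≤n; s≤s)
  import Data.Nat.Properties as ℕₚ
  open import Relation.Binary.PropositionalEquality as ≡ using (_≡_)
  open Ring R
  open RingOps R
  open import Algebra.Properties.Ring R using (-1*x≈-x; -‿distribˡ-*; -‿distribʳ-*)
  open import Algebra.Properties.CommutativeSemigroup +-commutativeSemigroup using (interchange)
  open import Algebra.Properties.Semiring.Mult semiring using (_×_; ×-homo-+; ×-congʳ; ×-congˡ; ×-assoc-*; ×-comm-*; ×1-homo-*)
  open import Algebra.Properties.Semiring.Exp semiring using (_^_; ^-homo-*; ^-congʳ)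
  open import Relation.Binary.Reasoning.Setoid setoid
  open Coefficients
    using (commCoeff; commCoeff-0-0; commCoeff-<; commCoeff-suc-suc; x-exponent; I-exponent; A-vanishes; A-suc)

  -- ∑ n f = f 0 + ⋯ + f (n-1). Unlike sumR it peels off the first term, which makes the
  -- reindexings in ∑-triangle and ∑-+-shiftˡ structural.
  ∑ : ℕ → (ℕ → Carrier) → Carrier
  ∑ zero    f = 0#
  ∑ (suc n) f = f 0 + ∑ n (λ i → f (suc i))

  infix 5 ∑
  syntax ∑ n (λ i → t) = ∑[ i < n ] t

  ∑-cong : ∀ n {f g} → (∀ i → i < n → f i ≈ g i) → ∑ n f ≈ ∑ n g
  ∑-cong zero    f≈g = refl
  ∑-cong (suc n) f≈g = +-cong (f≈g 0 (s≤s z≤n)) (∑-cong n (λ i i<n → f≈g (suc i) (s≤s i<n)))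

  ∑-distrib-+ : ∀ n f g → ∑[ i < n ] (f i + g i) ≈ ∑ n f + ∑ n g
  ∑-distrib-+ zero    f g = sym (+-identityˡ 0#)
  ∑-distrib-+ (suc n) f g = trans (+-congˡ (∑-distrib-+ n _ _)) (interchange _ _ _ _)

  *-distribˡ-∑ : ∀ n y f → y * ∑ n f ≈ ∑[ i < n ] (y * f i)
  *-distribˡ-∑ zero    y f = zeroʳ y
  *-distribˡ-∑ (suc n) y f = trans (distribˡ y _ _) (+-congˡ (*-distribˡ-∑ n y _))

  *-distribʳ-∑ : ∀ n y f → ∑ n f * y ≈ ∑[ i < n ] (f i * y)
  *-distribʳ-∑ zero    y f = zeroˡ y
  *-distribʳ-∑ (suc n) y f = trans (distribʳ y _ _) (+-congˡ (*-distribʳ-∑ n y _))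

  ∑-snoc : ∀ n f → ∑ (suc n) f ≈ ∑ n f + f n
  ∑-snoc zero    f = +-comm _ _
  ∑-snoc (suc n) f = trans (+-congˡ (∑-snoc n _)) (sym (+-assoc _ _ _))

  ∑-zero : ∀ n {f} → (∀ i → i < n → f i ≈ 0#) → ∑ n f ≈ 0#
  ∑-zero zero    f≈0 = refl
  ∑-zero (suc n) f≈0 = trans (+-cong (f≈0 0 (s≤s z≤n)) (∑-zero n (λ i i<n → f≈0 (suc i) (s≤s i<n)))) (+-identityˡ 0#)

  ∑-extend : ∀ {m n f} → m ≤ n → (∀ i → m ≤ i → i < n → f i ≈ 0#) → ∑ n f ≈ ∑ m f
  ∑-extend {zero}          _         f≈0 = ∑-zero _ (λ i → f≈0 i z≤n)
  ∑-extend {suc m} {suc n} (s≤s m≤n) f≈0 = +-congˡ (∑-extend m≤n (λ i m≤i i<n → f≈0 (suc i) (s≤s m≤i) (s≤s i<n)))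

  ∑-+-shiftˡ : ∀ n (f g : ℕ → Carrier) → f n ≈ 0# →
    ∑[ i < n ] (f i + g i) ≈ f 0 + (∑[ i < n ] (f (suc i) + g i))
  ∑-+-shiftˡ zero    f g f0≈0 = sym (trans (+-congʳ f0≈0) (+-identityˡ 0#))
  ∑-+-shiftˡ (suc n) f g fn≈0 = begin
    (f 0 + g 0) + (∑[ i < n ] (f (suc i) + g (suc i)))
      ≈⟨ +-congˡ (∑-+-shiftˡ n (λ i → f (suc i)) (λ i → g (suc i)) fn≈0) ⟩
    (f 0 + g 0) + (f 1 + rest)
      ≈⟨ +-assoc _ _ _ ⟩
    f 0 + (g 0 + (f 1 + rest))
      ≈⟨ +-congˡ (trans (sym (+-assoc _ _ _)) (+-congʳ (+-comm _ _))) ⟩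
    f 0 + ((f 1 + g 0) + rest)
      ∎
    where
    rest : Carrier
    rest = ∑[ i < n ] (f (suc (suc i)) + g (suc i))

  ∑-triangle : ∀ n (g : ℕ → ℕ → Carrier) →
    ∑[ k < n ] ∑ (n ∸ k) (g k) ≈ ∑[ j < n ] ∑[ k < suc j ] g k (j ∸ k)
  ∑-triangle zero    g = refl
  ∑-triangle (suc n) g = begin
    ∑ (suc n) (g 0) + (∑[ k < n ] ∑ (n ∸ k) (g (suc k)))
      ≈⟨ +-congˡ (∑-triangle n (λ k → g (suc k))) ⟩
    ∑ (suc n) (g 0) + (∑[ j < n ] ∑[ k < suc j ] g (suc k) (j ∸ k))
      ≈⟨ +-congˡ (+-identityˡ _) ⟨
    ∑ (suc n) (g 0) + (∑[ j < suc n ] ∑[ k < j ] g (suc k) (j ∸ suc k))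
      ≈⟨ ∑-distrib-+ (suc n) (g 0) (λ j → ∑[ k < j ] g (suc k) (j ∸ suc k)) ⟨
    ∑[ j < suc n ] ∑[ k < suc j ] g k (j ∸ k)
      ∎

  sumR≈∑ : ∀ N f → sumR N f ≈ ∑ (suc N) f
  sumR≈∑ zero    f = sym (+-identityʳ (f 0))
  sumR≈∑ (suc N) f = trans (+-congʳ (sumR≈∑ N f)) (sym (∑-snoc (suc N) f))

  Central : Carrier → Set (c ⊔ ℓ)
  Central z = ∀ y → z * y ≈ y * z

  central-* : ∀ {a b} → Central a → Central b → Central (a * b)
  central-* {a} {b} a-central b-central y = begin
    (a * b) * y ≈⟨ *-assoc a b y ⟩
    a * (b * y) ≈⟨ *-congˡ (b-central y) ⟩
    a * (y * b) ≈⟨ *-assoc a y b ⟨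
    (a * y) * b ≈⟨ *-congʳ (a-central y) ⟩
    (y * a) * b ≈⟨ *-assoc y a b ⟩
    y * (a * b) ∎

  central-float : ∀ {z} → Central z → ∀ y w → y * (z * w) ≈ z * (y * w)
  central-float {z} z-central y w = begin
    y * (z * w) ≈⟨ *-assoc y z w ⟨
    (y * z) * w ≈⟨ *-congʳ (z-central y) ⟨
    (z * y) * w ≈⟨ *-assoc z y w ⟩
    z * (y * w) ∎

  -1^-central : ∀ k → Central ((- 1#) ^ k)
  -1^-central zero    y = trans (*-identityˡ y) (sym (*-identityʳ y))
  -1^-central (suc k) y = begin
    (- 1# * (- 1#) ^ k) * y ≈⟨ *-assoc _ _ _ ⟩
    - 1# * ((- 1#) ^ k * y) ≈⟨ -1*x≈-x _ ⟩
    - ((- 1#) ^ k * y)      ≈⟨ -‿cong (-1^-central k y) ⟩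
    - (y * (- 1#) ^ k)      ≈⟨ -‿distribʳ-* y _ ⟩
    y * - (- 1#) ^ k        ≈⟨ *-congˡ (-1*x≈-x _) ⟨
    y * (- 1# * (- 1#) ^ k) ∎

  ×1-central : ∀ n → Central (n × 1#)
  ×1-central n y = begin
    (n × 1#) * y ≈⟨ ×-assoc-* n 1# y ⟩
    n × (1# * y) ≈⟨ ×-congʳ n (trans (*-identityˡ y) (sym (*-identityʳ y))) ⟩
    n × (y * 1#) ≈⟨ ×-comm-* n y 1# ⟨
    y * (n × 1#) ∎

  coeff : ℕ → ℕ → Carrier
  coeff k n = (- 1#) ^ k * (n × 1#)

  coeff-central : ∀ k n → Central (coeff k n)
  coeff-central k n = central-* (-1^-central k) (×1-central n)

  coeff-float : ∀ k n y w → y * (coeff k n * w) ≈ coeff k n * (y * w)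
  coeff-float k n = central-float (coeff-central k n)

  coeff-*-coeff : ∀ k m i n → coeff k m * coeff i n ≈ coeff (k ℕ.+ i) (m ℕ.* n)
  coeff-*-coeff k m i n = begin
    ((- 1#) ^ k * (m × 1#)) * ((- 1#) ^ i * (n × 1#)) ≈⟨ *-assoc _ _ _ ⟩
    (- 1#) ^ k * ((m × 1#) * ((- 1#) ^ i * (n × 1#))) ≈⟨ *-congˡ (central-float (-1^-central i) _ _) ⟩
    (- 1#) ^ k * ((- 1#) ^ i * ((m × 1#) * (n × 1#))) ≈⟨ *-assoc _ _ _ ⟨
    ((- 1#) ^ k * (- 1#) ^ i) * ((m × 1#) * (n × 1#)) ≈⟨ *-cong (^-homo-* (- 1#) k i) (×1-homo-* m n) ⟨
    coeff (k ℕ.+ i) (m ℕ.* n)                         ∎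

  coeff-+ : ∀ k m n → coeff k m + coeff k n ≈ coeff k (m ℕ.+ n)
  coeff-+ k m n = trans (sym (distribˡ _ _ _)) (*-congˡ (sym (×-homo-+ 1# m n)))

  coeff-suc : ∀ k n → coeff (suc k) n ≈ - coeff k n
  coeff-suc k n = trans (*-assoc _ _ _) (-1*x≈-x _)

  coeff-zero : ∀ k → coeff k 0 ≈ 0#
  coeff-zero k = zeroʳ _

  coeff-0-1 : coeff 0 1 ≈ 1#
  coeff-0-1 = trans (*-identityˡ _) (+-identityʳ 1#)

  ∑-coeff : ∀ N k f → ∑[ i < suc N ] coeff k (f i) ≈ coeff k (sumℕ N f)
  ∑-coeff zero    k f = +-identityʳ _
  ∑-coeff (suc N) k f = begin
    ∑[ i < suc (suc N) ] coeff k (f i)           ≈⟨ ∑-snoc (suc N) (λ i → coeff k (f i)) ⟩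
    (∑[ i < suc N ] coeff k (f i)) + coeff k (f (suc N)) ≈⟨ +-congʳ (∑-coeff N k f) ⟩
    coeff k (sumℕ N f) + coeff k (f (suc N))     ≈⟨ coeff-+ k (sumℕ N f) (f (suc N)) ⟩
    coeff k (sumℕ (suc N) f)                     ∎

  pow≡^ : ∀ y n → pow y n ≡ y ^ n
  pow≡^ y zero    = ≡.refl
  pow≡^ y (suc n) = ≡.cong (y *_) (pow≡^ y n)

  nmul≡× : ∀ n y → nmul n y ≡ n × y
  nmul≡× zero    y = ≡.refl
  nmul≡× (suc n) y = ≡.cong (y +_) (nmul≡× n y)

  sign-*-nmul≈coeff-* : ∀ k n y w → sign k * (nmul n y * w) ≈ coeff k n * (y * w)
  sign-*-nmul≈coeff-* k n y w = begin
    sign k * (nmul n y * w)            ≡⟨ ≡.cong₂ (λ s t → s * (t * w)) (pow≡^ (- 1#) k) (nmul≡× n y) ⟩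
    (- 1#) ^ k * ((n × y) * w)         ≈⟨ *-congˡ (×-assoc-* n y w) ⟩
    (- 1#) ^ k * (n × (y * w))         ≈⟨ *-congˡ (×-congʳ n (*-identityˡ (y * w))) ⟨
    (- 1#) ^ k * (n × (1# * (y * w)))  ≈⟨ *-congˡ (×-assoc-* n 1# (y * w)) ⟨
    (- 1#) ^ k * ((n × 1#) * (y * w))  ≈⟨ *-assoc _ _ _ ⟨
    coeff k n * (y * w)                ∎

  coeff-*-coeff-* : ∀ k m i n w → coeff k m * (coeff i n * w) ≈ coeff (k ℕ.+ i) (m ℕ.* n) * w
  coeff-*-coeff-* k m i n w = trans (sym (*-assoc _ _ w)) (*-congʳ (coeff-*-coeff k m i n))

  -‿coeff-* : ∀ k n w → - (coeff k n * w) ≈ coeff (suc k) n * w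
  -‿coeff-* k n w = trans (-‿distribˡ-* _ w) (*-congʳ (sym (coeff-suc k n)))

  ^-sucʳ : ∀ y n → y ^ n * y ≈ y ^ suc n
  ^-sucʳ y n = begin
    y ^ n * y        ≈⟨ *-congˡ (*-identityʳ y) ⟨
    y ^ n * y ^ 1    ≈⟨ ^-homo-* y n 1 ⟨
    y ^ (n ℕ.+ 1)    ≈⟨ ^-congʳ y (ℕₚ.+-comm n 1) ⟩
    y ^ suc n        ∎

  module Commutation (x I : Carrier) (I*x-x*I≈-I*I : I * x - x * I ≈ - (I * I)) where

    I*x≈x*I-I*I : I * x ≈ x * I - I * I
    I*x≈x*I-I*I = begin
      I * x                   ≈⟨ //-rightDividesˡ (x * I) (I * x) ⟨
      (I * x - x * I) + x * I ≈⟨ +-congʳ I*x-x*I≈-I*I ⟩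
      - (I * I) + x * I       ≈⟨ +-comm _ _ ⟩
      x * I - I * I           ∎
      where open import Algebra.Properties.Group +-group using (//-rightDividesˡ)

    I^*x : ∀ q → I ^ q * x ≈ x * I ^ q + coeff 1 q * I ^ suc q
    I^*x zero = begin
      1# * x                     ≈⟨ trans (*-identityˡ x) (sym (*-identityʳ x)) ⟩
      x * 1#                     ≈⟨ +-identityʳ _ ⟨
      x * 1# + 0#                ≈⟨ +-congˡ (trans (*-congʳ (coeff-zero 1)) (zeroˡ _)) ⟨
      x * 1# + coeff 1 0 * I ^ 1 ∎
    I^*x (suc q) = begin
      (I * I ^ q) * x
        ≈⟨ *-assoc I (I ^ q) x ⟩
      I * (I ^ q * x)
        ≈⟨ *-congˡ (I^*x q) ⟩
      I * (x * I ^ q + coeff 1 q * I ^ suc q)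
        ≈⟨ distribˡ I _ _ ⟩
      I * (x * I ^ q) + I * (coeff 1 q * I ^ suc q)
        ≈⟨ +-cong (sym (*-assoc I x (I ^ q))) (coeff-float 1 q I (I ^ suc q)) ⟩
      (I * x) * I ^ q + coeff 1 q * I ^ suc (suc q)
        ≈⟨ +-congʳ (trans (*-congʳ I*x≈x*I-I*I) (distribʳ (I ^ q) _ _)) ⟩
      (x * I * I ^ q + - (I * I) * I ^ q) + coeff 1 q * I ^ suc (suc q)
        ≈⟨ +-assoc _ _ _ ⟩
      x * I * I ^ q + (- (I * I) * I ^ q + coeff 1 q * I ^ suc (suc q))
        ≈⟨ +-cong (*-assoc x I (I ^ q)) (+-congʳ (trans (sym (-‿distribˡ-* _ _)) (-‿cong (*-assoc I I (I ^ q))))) ⟩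
      x * I ^ suc q + (- I ^ suc (suc q) + coeff 1 q * I ^ suc (suc q))
        ≈⟨ +-congˡ (+-congʳ (trans (-‿cong (sym (trans (*-congʳ coeff-0-1) (*-identityˡ _)))) (-‿coeff-* 0 1 _))) ⟩
      x * I ^ suc q + (coeff 1 1 * I ^ suc (suc q) + coeff 1 q * I ^ suc (suc q))
        ≈⟨ +-congˡ (trans (sym (distribʳ _ _ _)) (*-congʳ (coeff-+ 1 1 q))) ⟩
      x * I ^ suc q + coeff 1 (suc q) * I ^ suc (suc q)
        ∎

    mon : ℕ → ℕ → Carrier
    mon p q = x ^ p * I ^ q

    mon-*-x : ∀ p q → mon p q * x ≈ mon (suc p) q + coeff 1 q * mon p (suc q)
    mon-*-x p q = begin
      (x ^ p * I ^ q) * x                                    ≈⟨ *-assoc _ _ _ ⟩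
      x ^ p * (I ^ q * x)                                    ≈⟨ *-congˡ (I^*x q) ⟩
      x ^ p * (x * I ^ q + coeff 1 q * I ^ suc q)            ≈⟨ distribˡ _ _ _ ⟩
      x ^ p * (x * I ^ q) + x ^ p * (coeff 1 q * I ^ suc q)  ≈⟨ +-cong (sym (*-assoc _ _ _)) (coeff-float 1 q _ _) ⟩
      (x ^ p * x) * I ^ q + coeff 1 q * mon p (suc q)        ≈⟨ +-congʳ (*-congʳ (^-sucʳ x p)) ⟩
      mon (suc p) q + coeff 1 q * mon p (suc q)              ∎

    x^*mon*I^ : ∀ a p q r → x ^ a * (mon p q * I ^ r) ≈ mon (a ℕ.+ p) (q ℕ.+ r)
    x^*mon*I^ a p q r = begin
      x ^ a * ((x ^ p * I ^ q) * I ^ r)  ≈⟨ *-congˡ (*-assoc _ _ _) ⟩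
      x ^ a * (x ^ p * (I ^ q * I ^ r))  ≈⟨ *-assoc _ _ _ ⟨
      (x ^ a * x ^ p) * (I ^ q * I ^ r)  ≈⟨ *-cong (^-homo-* x a p) (^-homo-* I q r) ⟨
      mon (a ℕ.+ p) (q ℕ.+ r)            ∎

    module _ (e : ℕ) where
      private
        δ : ℕ
        δ = suc e

      normalOrder-I^*x^ : ∀ m →
        I ^ δ * x ^ m ≈ ∑[ i < suc m ] coeff i (commCoeff e m i) * mon (m ∸ i) (δ ℕ.+ i)
      normalOrder-I^*x^ zero = begin
        I ^ δ * 1#                                   ≈⟨ *-identityʳ _ ⟩
        I ^ δ                                        ≈⟨ trans (*-identityˡ _) (^-congʳ I (ℕₚ.+-identityʳ δ)) ⟨
        mon 0 (δ ℕ.+ 0)                              ≈⟨ trans (*-congʳ coeff-0-0≈1) (*-identityˡ _) ⟨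
        coeff 0 (commCoeff e 0 0) * mon 0 (δ ℕ.+ 0)  ≈⟨ +-identityʳ _ ⟨
        ∑[ i < 1 ] coeff i (commCoeff e 0 i) * mon (0 ∸ i) (δ ℕ.+ i) ∎
        where
        coeff-0-0≈1 : coeff 0 (commCoeff e 0 0) ≈ 1#
        coeff-0-0≈1 = trans (*-congˡ (×-congˡ (commCoeff-0-0 e))) coeff-0-1
      normalOrder-I^*x^ (suc m) = begin
        I ^ δ * x ^ suc m                          ≈⟨ *-congˡ (^-sucʳ x m) ⟨
        I ^ δ * (x ^ m * x)                        ≈⟨ *-assoc _ _ _ ⟨
        (I ^ δ * x ^ m) * x                        ≈⟨ *-congʳ (normalOrder-I^*x^ m) ⟩
        ∑ (suc m) (T m) * x                        ≈⟨ *-distribʳ-∑ (suc m) x (T m) ⟩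
        ∑[ i < suc m ] (T m i * x)                 ≈⟨ ∑-cong (suc m) (λ i i<1+m → T-*-x i (ℕₚ.≤-pred i<1+m)) ⟩
        ∑[ i < suc m ] (U i + V i)                 ≈⟨ ∑-+-shiftˡ (suc m) U V U[1+m]≈0 ⟩
        U 0 + (∑[ i < suc m ] (U (suc i) + V i))   ≈⟨ +-congˡ (∑-cong (suc m) (λ i _ → U+V i)) ⟩
        ∑[ i < suc (suc m) ] T (suc m) i           ∎
        where
        T : ℕ → ℕ → Carrier
        T n i = coeff i (commCoeff e n i) * mon (n ∸ i) (δ ℕ.+ i)
        cₘ v : ℕ → ℕ
        cₘ i = commCoeff e m i
        v i = suc (e ℕ.+ i) ℕ.* cₘ i
        U V : ℕ → Carrier
        U i = coeff i (cₘ i) * mon (suc m ∸ i) (δ ℕ.+ i)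
        V i = coeff (suc i) (v i) * mon (m ∸ i) (δ ℕ.+ suc i)

        U[1+m]≈0 : U (suc m) ≈ 0#
        U[1+m]≈0 = begin
          coeff (suc m) (cₘ (suc m)) * _ ≈⟨ *-congʳ (*-congˡ (×-congˡ (commCoeff-< e (ℕₚ.n<1+n m)))) ⟩
          coeff (suc m) 0 * _           ≈⟨ trans (*-congʳ (coeff-zero (suc m))) (zeroˡ _) ⟩
          0#                            ∎

        T-*-x : ∀ i → i ≤ m → T m i * x ≈ U i + V i
        T-*-x i i≤m = begin
          (coeff i (cₘ i) * mon (m ∸ i) b) * x
            ≈⟨ *-assoc _ _ _ ⟩
          coeff i (cₘ i) * (mon (m ∸ i) b * x)
            ≈⟨ *-congˡ (mon-*-x (m ∸ i) b) ⟩
          coeff i (cₘ i) * (mon (suc (m ∸ i)) b + coeff 1 b * mon (m ∸ i) (suc b))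
            ≈⟨ distribˡ _ _ _ ⟩
          coeff i (cₘ i) * mon (suc (m ∸ i)) b + coeff i (cₘ i) * (coeff 1 b * mon (m ∸ i) (suc b))
            ≈⟨ +-congˡ (trans (coeff-float 1 b _ _) (coeff-*-coeff-* 1 b i (cₘ i) _)) ⟩
          coeff i (cₘ i) * mon (suc (m ∸ i)) b + coeff (suc i) (v i) * mon (m ∸ i) (suc b)
            ≡⟨ ≡.cong₂ (λ p q → coeff i (cₘ i) * mon p b + coeff (suc i) (v i) * mon (m ∸ i) q)
                 (ℕₚ.+-∸-assoc 1 i≤m) (ℕₚ.+-suc δ i) ⟨
          U i + V i
            ∎
          where
          b : ℕ
          b = δ ℕ.+ i

        U+V : ∀ i → U (suc i) + V i ≈ T (suc m) (suc i)
        U+V i = begin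
          coeff (suc i) (cₘ (suc i)) * w + coeff (suc i) (v i) * w  ≈⟨ distribʳ _ _ _ ⟨
          (coeff (suc i) (cₘ (suc i)) + coeff (suc i) (v i)) * w    ≈⟨ *-congʳ (coeff-+ (suc i) (cₘ (suc i)) (v i)) ⟩
          coeff (suc i) (cₘ (suc i) ℕ.+ v i) * w                    ≡⟨ ≡.cong (λ n → coeff (suc i) n * w) cₘ-Pascal ⟨
          T (suc m) (suc i)                                        ∎
          where
          w : Carrier
          w = mon (m ∸ i) (δ ℕ.+ suc i)
          cₘ-Pascal : commCoeff e (suc m) (suc i) ≡ cₘ (suc i) ℕ.+ v i
          cₘ-Pascal = commCoeff-suc-suc e m i

      module _ (λ' : ℕ) where
        X : Carrier
        X = x ^ λ' * I ^ δ

        normalOrder-X*mon : ∀ p q →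
          X * mon p q ≈ ∑[ i < suc p ] coeff i (commCoeff e p i) * mon (λ' ℕ.+ (p ∸ i)) (δ ℕ.+ i ℕ.+ q)
        normalOrder-X*mon p q = begin
          (x ^ λ' * I ^ δ) * (x ^ p * I ^ q)       ≈⟨ *-assoc _ _ _ ⟩
          x ^ λ' * (I ^ δ * (x ^ p * I ^ q))       ≈⟨ *-congˡ (*-assoc _ _ _) ⟨
          x ^ λ' * ((I ^ δ * x ^ p) * I ^ q)       ≈⟨ *-congˡ (*-congʳ (normalOrder-I^*x^ p)) ⟩
          x ^ λ' * (∑ (suc p) T * I ^ q)           ≈⟨ *-congˡ (*-distribʳ-∑ (suc p) (I ^ q) T) ⟩
          x ^ λ' * (∑[ i < suc p ] (T i * I ^ q))  ≈⟨ *-distribˡ-∑ (suc p) (x ^ λ') (λ i → T i * I ^ q) ⟩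
          ∑[ i < suc p ] (x ^ λ' * (T i * I ^ q))  ≈⟨ ∑-cong (suc p) (λ i _ → x^λ'*T*I^q i) ⟩
          ∑[ i < suc p ] coeff i (cₚ i) * mon (λ' ℕ.+ (p ∸ i)) (δ ℕ.+ i ℕ.+ q) ∎
          where
          cₚ : ℕ → ℕ
          cₚ i = commCoeff e p i
          T : ℕ → Carrier
          T i = coeff i (cₚ i) * mon (p ∸ i) (δ ℕ.+ i)
          x^λ'*T*I^q : ∀ i → x ^ λ' * (T i * I ^ q) ≈ coeff i (cₚ i) * mon (λ' ℕ.+ (p ∸ i)) (δ ℕ.+ i ℕ.+ q)
          x^λ'*T*I^q i = begin
            x ^ λ' * ((coeff i (cₚ i) * mon (p ∸ i) (δ ℕ.+ i)) * I ^ q)  ≈⟨ *-congˡ (*-assoc _ _ _) ⟩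
            x ^ λ' * (coeff i (cₚ i) * (mon (p ∸ i) (δ ℕ.+ i) * I ^ q))  ≈⟨ coeff-float i (cₚ i) (x ^ λ') _ ⟩
            coeff i (cₚ i) * (x ^ λ' * (mon (p ∸ i) (δ ℕ.+ i) * I ^ q))  ≈⟨ *-congˡ (x^*mon*I^ λ' (p ∸ i) (δ ℕ.+ i) q) ⟩
            coeff i (cₚ i) * mon (λ' ℕ.+ (p ∸ i)) (δ ℕ.+ i ℕ.+ q)        ∎

        term : ℕ → ℕ → ℕ → Carrier
        term m j n = coeff j n * mon (λ' ℕ.* suc m ∸ j) (δ ℕ.* suc m ℕ.+ j)

        normalOrder-X*term : ∀ m k n → k ≤ λ' ℕ.* suc m →
          X * term m k n ≈
            ∑[ i < suc (λ' ℕ.* suc m) ∸ k ] term (suc m) (k ℕ.+ i) (n ℕ.* commCoeff e (λ' ℕ.* suc m ∸ k) i)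
        normalOrder-X*term m k n k≤λ'[1+m] = begin
          X * (coeff k n * mon p q)                  ≈⟨ coeff-float k n X (mon p q) ⟩
          coeff k n * (X * mon p q)                  ≈⟨ *-congˡ (normalOrder-X*mon p q) ⟩
          coeff k n * ∑ (suc p) Y                    ≈⟨ *-distribˡ-∑ (suc p) (coeff k n) Y ⟩
          ∑[ i < suc p ] coeff k n * Y i             ≈⟨ ∑-cong (suc p) (λ i i<1+p → coeff-*-Y i (ℕₚ.≤-pred i<1+p)) ⟩
          ∑[ i < suc p ] Z i                         ≡⟨ ≡.cong (λ t → ∑ t Z) (ℕₚ.+-∸-assoc 1 k≤λ'[1+m]) ⟨
          ∑[ i < suc (λ' ℕ.* suc m) ∸ k ] Z i         ∎
          where
          p q : ℕ
          p = λ' ℕ.* suc m ∸ k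
          q = δ ℕ.* suc m ℕ.+ k
          Y Z : ℕ → Carrier
          Y i = coeff i (commCoeff e p i) * mon (λ' ℕ.+ (p ∸ i)) (δ ℕ.+ i ℕ.+ q)
          Z i = term (suc m) (k ℕ.+ i) (n ℕ.* commCoeff e p i)
          coeff-*-Y : ∀ i → i ≤ p → coeff k n * Y i ≈ Z i
          coeff-*-Y i i≤p = begin
            coeff k n * Y i
              ≈⟨ coeff-*-coeff-* k n i (commCoeff e p i) _ ⟩
            coeff (k ℕ.+ i) (n ℕ.* commCoeff e p i) * mon (λ' ℕ.+ (p ∸ i)) (δ ℕ.+ i ℕ.+ q)
              ≡⟨ ≡.cong₂ (λ a b → coeff (k ℕ.+ i) (n ℕ.* commCoeff e p i) * mon a b)
                   (x-exponent λ' m {k} {i} k+i≤λ'[1+m]) (I-exponent δ m k i) ⟩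
            Z i
              ∎
            where
            k+i≤λ'[1+m] : k ℕ.+ i ≤ λ' ℕ.* suc m
            k+i≤λ'[1+m] = ℕₚ.≤-trans (ℕₚ.+-monoʳ-≤ k i≤p) (ℕₚ.≤-reflexive (ℕₚ.m+[n∸m]≡n k≤λ'[1+m]))

        normalOrder-X*∑ : ∀ m →
          X * (∑[ k < suc (λ' ℕ.* m) ] term m k (A λ' δ m k)) ≈
            ∑[ j < suc (λ' ℕ.* suc m) ] term (suc m) j (A λ' δ (suc m) j)
        normalOrder-X*∑ m = begin
          X * (∑[ k < suc (λ' ℕ.* m) ] term m k (A λ' δ m k))
            ≈⟨ *-congˡ (∑-extend (s≤s (ℕₚ.*-monoʳ-≤ λ' (ℕₚ.n≤1+n m))) A-tail≈0) ⟨
          X * (∑[ k < suc p ] term m k (A λ' δ m k))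
            ≈⟨ *-distribˡ-∑ (suc p) X (λ k → term m k (A λ' δ m k)) ⟩
          ∑[ k < suc p ] X * term m k (A λ' δ m k)
            ≈⟨ ∑-cong (suc p) (λ k k<1+p → normalOrder-X*term m k (A λ' δ m k) (ℕₚ.≤-pred k<1+p)) ⟩
          ∑[ k < suc p ] ∑ (suc p ∸ k) (G k)
            ≈⟨ ∑-triangle (suc p) G ⟩
          ∑[ j < suc p ] ∑[ k < suc j ] G k (j ∸ k)
            ≈⟨ ∑-cong (suc p) (λ j _ → collect j) ⟩
          ∑[ j < suc p ] term (suc m) j (A λ' δ (suc m) j)
            ∎
          where
          p : ℕ
          p = λ' ℕ.* suc m
          G : ℕ → ℕ → Carrier
          G k i = term (suc m) (k ℕ.+ i) (A λ' δ m k ℕ.* commCoeff e (p ∸ k) i)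
          A-tail≈0 : ∀ k → suc (λ' ℕ.* m) ≤ k → k < suc p → term m k (A λ' δ m k) ≈ 0#
          A-tail≈0 k λ'm<k _ = begin
            coeff k (A λ' δ m k) * _  ≈⟨ *-congʳ (*-congˡ (×-congˡ (A-vanishes λ' e λ'm<k))) ⟩
            coeff k 0 * _            ≈⟨ trans (*-congʳ (coeff-zero k)) (zeroˡ _) ⟩
            0#                       ∎
          collect : ∀ j → ∑[ k < suc j ] G k (j ∸ k) ≈ term (suc m) j (A λ' δ (suc m) j)
          collect j = begin
            ∑[ k < suc j ] G k (j ∸ k)          ≈⟨ ∑-cong (suc j) (λ k k<1+j → reflexive (G-diagonal k k<1+j)) ⟩
            ∑[ k < suc j ] coeff j (f k) * w    ≈⟨ *-distribʳ-∑ (suc j) w (λ k → coeff j (f k)) ⟨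
            (∑[ k < suc j ] coeff j (f k)) * w  ≈⟨ *-congʳ (∑-coeff j j f) ⟩
            coeff j (sumℕ j f) * w              ≡⟨ ≡.cong (λ n → coeff j n * w) (A-suc λ' e m j) ⟨
            term (suc m) j (A λ' δ (suc m) j)    ∎
            where
            f : ℕ → ℕ
            f k = A λ' δ m k ℕ.* commCoeff e (p ∸ k) (j ∸ k)
            w : Carrier
            w = mon (λ' ℕ.* suc (suc m) ∸ j) (δ ℕ.* suc (suc m) ℕ.+ j)
            G-diagonal : ∀ k → k < suc j → G k (j ∸ k) ≡ coeff j (f k) * w
            G-diagonal k k<1+j = ≡.cong (λ t → term (suc m) t (f k)) (ℕₚ.m+[n∸m]≡n (ℕₚ.≤-pred k<1+j))

        normalOrder-X^ : ∀ m → X ^ suc m ≈ ∑[ k < suc (λ' ℕ.* m) ] term m k (A λ' δ m k)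
        normalOrder-X^ zero = begin
          X * 1#                                       ≈⟨ *-identityʳ X ⟩
          mon λ' δ                                      ≡⟨ ≡.cong₂ mon λ'*1≡λ' δ*1+0≡δ ⟨
          mon (λ' ℕ.* 1 ∸ 0) (δ ℕ.* 1 ℕ.+ 0)            ≈⟨ trans (*-congʳ coeff-0-1) (*-identityˡ _) ⟨
          term 0 0 1                                   ≈⟨ +-identityʳ _ ⟨
          ∑[ k < 1 ] term 0 k (A λ' δ 0 k)              ≡⟨ ≡.cong (λ t → ∑ (suc t) (λ k → term 0 k (A λ' δ 0 k))) (ℕₚ.*-zeroʳ λ') ⟨
          ∑[ k < suc (λ' ℕ.* 0) ] term 0 k (A λ' δ 0 k)  ∎
          where
          λ'*1≡λ' : λ' ℕ.* 1 ≡ λ'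
          λ'*1≡λ' = ℕₚ.*-identityʳ λ'
          δ*1+0≡δ : δ ℕ.* 1 ℕ.+ 0 ≡ δ
          δ*1+0≡δ = ≡.trans (ℕₚ.+-identityʳ _) (ℕₚ.*-identityʳ δ)
        normalOrder-X^ (suc m) = trans (*-congˡ (normalOrder-X^ m)) (normalOrder-X*∑ m)

        pow-X≈sumR : ∀ m →
          pow (pow x λ' * pow I δ) (suc m) ≈
            sumR (λ' ℕ.* m) (λ k → sign k * (nmul (A λ' δ m k) (pow x (λ' ℕ.* suc m ∸ k)) * pow I (δ ℕ.* suc m ℕ.+ k)))
        pow-X≈sumR m = begin
          pow (pow x λ' * pow I δ) (suc m)              ≡⟨ pow-X≡X^ ⟩
          X ^ suc m                                    ≈⟨ normalOrder-X^ m ⟩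
          ∑[ k < suc (λ' ℕ.* m) ] term m k (A λ' δ m k)  ≈⟨ ∑-cong (suc (λ' ℕ.* m)) (λ k _ → summand≈term k) ⟨
          ∑ (suc (λ' ℕ.* m)) summand                    ≈⟨ sumR≈∑ (λ' ℕ.* m) summand ⟨
          sumR (λ' ℕ.* m) summand                       ∎
          where
          pow-X≡X^ : pow (pow x λ' * pow I δ) (suc m) ≡ X ^ suc m
          pow-X≡X^ = ≡.trans (pow≡^ _ (suc m)) (≡.cong (_^ suc m) (≡.cong₂ _*_ (pow≡^ x λ') (pow≡^ I δ)))
          summand : ℕ → Carrier
          summand k = sign k * (nmul (A λ' δ m k) (pow x (λ' ℕ.* suc m ∸ k)) * pow I (δ ℕ.* suc m ℕ.+ k))
          summand≈term : ∀ k → summand k ≈ term m k (A λ' δ m k)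
          summand≈term k = trans (sign-*-nmul≈coeff-* k (A λ' δ m k) _ _)
            (*-congˡ (reflexive (≡.cong₂ _*_ (pow≡^ x (λ' ℕ.* suc m ∸ k)) (pow≡^ I (δ ℕ.* suc m ℕ.+ k)))))

open import Data.Nat using (ℕ; suc; _*_; _∸_; _+_; _≤_; s≤s; z≤n)
open Ring using (Carrier; _≈_; _-_; -_) renaming (_*_ to mul)
open RingOps using (pow; nmul; sign; sumR)

theorem2 : {c ℓ : Level} (R : Ring c ℓ) (x I : Carrier R) →
    _≈_ R (_-_ R (mul R I x) (mul R x I)) (-_ R (mul R I I)) →
    (λ' δ : ℕ) → 1 ≤ λ' → 1 ≤ δ →
    (n : ℕ) → 1 ≤ n →
    _≈_ R
      (pow R (mul R (pow R x λ') (pow R I δ)) n)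
      (sumR R (λ' * (n ∸ 1)) (λ k →
        mul R (sign R k)
          (mul R (nmul R (a λ' δ n k) (pow R x (λ' * n ∸ k))) (pow R I (δ * n + k)))))
theorem2 R x I I*x-x*I≈-I*I λ' (suc e) _ (s≤s z≤n) (suc m) (s≤s z≤n) =
  Expansion.Commutation.pow-X≈sumR R x I I*x-x*I≈-I*I e λ' m
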